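{- For every $n\geq 9$, the wheel $W_n$ has an interval total $(n+4)$-coloring; consequently $W_\tau(W_n)\geq n+4$.
   Context: All graphs are finite, undirected, without loops or multiple edges. For $n\geq 4$ the wheel $W_n$ has vertex set $\{u,v_1,\ldots,v_{n-1}\}$ and edge set $\{uv_i:1\leq i\leq n-1\}\cup\{v_iv_{i+1}:1\leq i\leq n-2\}\cup\{v_1v_{n-1}\}$. A total coloring of a graph $G$ is an assignment of colors to the vertices and edges of $G$ such that no two adjacent vertices, no two adjacent edges, and no vertex and an edge incident to it receive the same color. For a positive integer $t$, an interval total $t$-coloring of $G$ is a total coloring of $G$ with colors $1,2,\ldots,t$ such that each color $i\in\{1,\ldots,t\}$ is used on at least one vertex or edge, and for each vertex $v$ the set consisting of the color of $v$ and the colors of the edges incident to $v$ consists of $d_G(v)+1$ consecutive integers, where $d_G(v)$ is the degree of $v$. For a graph $G$ having some interval total coloring, $W_\tau(G)$ is the greatest $t$ for which $G$ has an interval total $t$-coloring. -}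

module Defs where

open import Data.Nat using (ℕ; zero; suc; _+_; _∸_; _≤_; _≡ᵇ_)
open import Data.Nat.ListAction using (sum)
open import Data.Bool using (Bool; true; false; _∧_; _∨_; T; if_then_else_)
open import Data.Fin using (Fin; toℕ)
open import Data.List using (List; map; allFin)
open import Data.Product using (Σ; ∃; _×_; _,_)
open import Data.Sum using (_⊎_)
open import Relation.Binary.PropositionalEquality using (_≡_; _≢_)
open import Function.Bundles using (_⇔_)

record Graph : Set where
  field
    V   : ℕ
    adj : Fin V → Fin V → Bool

open Graph public

Adj : (G : Graph) → Fin (V G) → Fin (V G) → Set
Adj G x y = T (adj G x y)

degree : (G : Graph) → Fin (V G) → ℕ
degree G x = sum (map (λ y → if adj G x y then 1 else 0) (allFin (V G)))

-- Adjacency of the wheel W_n on vertex labels 0..n-1: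
-- 0 is the hub u, label i (1 ≤ i ≤ n-1) is the rim vertex v_i;
-- rim edges v_i v_{i+1} (1 ≤ i ≤ n-2) and v_1 v_{n-1}.
wheelAdjℕ : ℕ → ℕ → ℕ → Bool
wheelAdjℕ n zero    zero    = false
wheelAdjℕ n zero    (suc _) = true
wheelAdjℕ n (suc _) zero    = true
wheelAdjℕ n (suc i) (suc j) =
  (suc (suc i) ≡ᵇ suc j) ∨ (suc (suc j) ≡ᵇ suc i)
  ∨ ((suc i ≡ᵇ 1) ∧ (suc j ≡ᵇ n ∸ 1))
  ∨ ((suc j ≡ᵇ 1) ∧ (suc i ≡ᵇ n ∸ 1))

-- The wheel W_n (meaningful for n ≥ 4), vertex set Fin n.
Wheel : ℕ → Graph
Wheel n = record { V = n ; adj = λ x y → wheelAdjℕ n (toℕ x) (toℕ y) }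

-- An interval total t-coloring of G: vertex colouring c, edge colouring e
-- (e x y is the colour of edge xy, only meaningful when x,y adjacent).
record IntervalTotalColoring (G : Graph) (t : ℕ) : Set where
  field
    c : Fin (V G) → ℕ
    e : Fin (V G) → Fin (V G) → ℕ
    e-sym       : ∀ x y → Adj G x y → e x y ≡ e y x
    c-range     : ∀ x → 1 ≤ c x × c x ≤ t
    e-range     : ∀ x y → Adj G x y → 1 ≤ e x y × e x y ≤ t
    vert-proper : ∀ x y → Adj G x y → c x ≢ c y
    edge-proper : ∀ x y z → Adj G x y → Adj G x z → y ≢ z → e x y ≢ e x z
    inc-proper  : ∀ x y → Adj G x y → c x ≢ e x y
    surj        : ∀ i → 1 ≤ i → i ≤ t →
                  (∃ λ x → c x ≡ i) ⊎ (∃ λ x → ∃ λ y → Adj G x y × e x y ≡ i)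
    interval    : ∀ x → ∃ λ a → ∀ k →
                  ((a ≤ k × k ≤ a + degree G x) ⇔
                   (c x ≡ k ⊎ (∃ λ y → Adj G x y × e x y ≡ k)))

-- Write m = n - 1 for the number of rim vertices. The hub gets colour 7 and the spokes the
-- other colours of the hub interval [3, m + 3]: going once around the rim, the spokes run
-- upwards through the odd colours 3, 5, 9, 11, … and back down through the even ones …, 6, 4.
-- At a rim vertex with spoke s whose neighbours have spokes s - 2 and s + 2, colouring the
-- vertex s - 2 and the rim edges by the averages s - 1 and s + 1 of the adjacent spokes makes
-- its four colours consecutive. Around the hub colour 7 and at the two turning points of the
-- spoke sequence this pattern is perturbed, so that the rim reaches down to colours 1, 2 and up
-- to m + 4, m + 5 = n + 4. At the hub the interval condition needs no bookkeeping: m + 1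
-- distinct colours in an interval of m + 1 integers fill it.

module Submission where

open import Defs
open import Data.Nat using (ℕ; zero; suc; pred; _+_; _∸_; _≤_; _<_; z≤n; s≤s; z<s; s<s; _≡ᵇ_)
open import Data.Nat.Properties
open import Data.Nat.ListAction using (sum)
open import Data.Bool using (Bool; true; false; _∧_; _∨_; T; if_then_else_)
open import Data.Bool.Properties using (T-∨; T-∧; ∨-identityʳ)
open import Data.Fin using (Fin; toℕ; fromℕ<; punchOut) renaming (zero to hubVertex; suc to rimVertex)
open import Data.Fin.Properties using (any?; pigeonhole; punchOut-injective; toℕ-fromℕ<; toℕ<n; toℕ-injective)
import Data.Fin.Properties as Fin
open import Data.List using (List; []; _∷_; length; applyUpTo; upTo; map; tabulate; allFin)
open import Data.List.Properties using (map-tabulate)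
open import Data.List.Membership.Propositional using (_∈_)
open import Data.List.Membership.Propositional.Properties using (∈-applyUpTo⁺; ∈-applyUpTo⁻)
open import Data.List.Relation.Unary.Any using (here; there)
open import Data.List.Relation.Unary.All using ([]; _∷_)
open import Data.List.Relation.Unary.AllPairs using ([]; _∷_)
open import Data.List.Relation.Unary.Unique.Propositional using (Unique)
open import Data.List.Relation.Unary.Unique.Propositional.Properties using (applyUpTo⁺₁)
open import Data.List.Relation.Binary.Permutation.Propositional
  using (_↭_; ↭-refl; ↭-prep; ↭-swap; ↭-trans; ↭-sym; ↭⇒↭ₛ)
open import Data.List.Relation.Binary.Permutation.Propositional.Properties using (∈-resp-↭; map⁺)
import Data.List.Relation.Binary.Permutation.Setoid.Properties as ↭ₛ
open import Data.Product using (Σ; ∃; ∃₂; _×_; _,_; proj₁; proj₂)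
open import Data.Sum using (_⊎_; inj₁; inj₂)
import Data.Sum as Sum
open import Data.Empty using (⊥; ⊥-elim)
open import Function using (_∘_; id)
open import Function.Bundles using (_⇔_; mk⇔; Equivalence)
open import Function.Construct.Composition using (_⇔-∘_)
open import Function.Construct.Symmetry using (⇔-sym)
open import Relation.Nullary using (yes; no)
open import Relation.Binary.Definitions using (tri<; tri≈; tri>)
open import Relation.Binary.PropositionalEquality

count : (ℕ → Bool) → ℕ → ℕ
count p zero    = 0
count p (suc n) = (if p 0 then 1 else 0) + count (p ∘ suc) n

sum-allFin-indicator : ∀ n (p : ℕ → Bool) →
  sum (map (λ y → if p (toℕ y) then 1 else 0) (allFin n)) ≡ count p n
sum-allFin-indicator n p = trans (cong sum (map-tabulate {n = n} id indicator)) (sum-tabulate n p)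
  where
  indicator : Fin n → ℕ
  indicator y = if p (toℕ y) then 1 else 0
  sum-tabulate : ∀ n (p : ℕ → Bool) →
                 sum (tabulate {n = n} (λ y → if p (toℕ y) then 1 else 0)) ≡ count p n
  sum-tabulate zero    p = refl
  sum-tabulate (suc n) p = cong ((if p 0 then 1 else 0) +_) (sum-tabulate n (p ∘ suc))

count-cong : ∀ {n} {p q : ℕ → Bool} → (∀ {j} → j < n → p j ≡ q j) → count p n ≡ count q n
count-cong {zero}  p≗q = refl
count-cong {suc n} p≗q = cong₂ (λ b c → (if b then 1 else 0) + c) (p≗q z<s) (count-cong (p≗q ∘ s<s))

count-true : ∀ n → count (λ _ → true) n ≡ n
count-true zero    = refl
count-true (suc n) = cong suc (count-true n)

count-false : ∀ n → count (λ _ → false) n ≡ 0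
count-false zero    = refl
count-false (suc n) = count-false n

count-≡ᵇ : ∀ {n a} → a < n → count (_≡ᵇ a) n ≡ 1
count-≡ᵇ {suc n} {zero}  _         = cong suc (count-false n)
count-≡ᵇ {suc n} {suc a} (s≤s a<n) = count-≡ᵇ a<n

count-≡ᵇ-pair : ∀ {n a b} → a ≢ b → a < n → b < n →
                count (λ j → (j ≡ᵇ a) ∨ (j ≡ᵇ b)) n ≡ 2
count-≡ᵇ-pair {suc n} {zero}  {zero}  a≢b _ _ = ⊥-elim (a≢b refl)
count-≡ᵇ-pair {suc n} {zero}  {suc b} _ _ (s≤s b<n) = cong suc (count-≡ᵇ b<n)
count-≡ᵇ-pair {suc n} {suc a} {zero}  _ (s≤s a<n) _ =
  cong suc (trans (count-cong {n} (λ {j} _ → ∨-identityʳ (j ≡ᵇ a))) (count-≡ᵇ a<n))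
count-≡ᵇ-pair {suc n} {suc a} {suc b} a≢b (s≤s a<n) (s≤s b<n) =
  count-≡ᵇ-pair (a≢b ∘ cong suc) a<n b<n

T-injective : ∀ {x y} → T x ⇔ T y → x ≡ y
T-injective {false} {false} _ = refl
T-injective {false} {true}  h = ⊥-elim (Equivalence.from h _)
T-injective {true}  {false} h = ⊥-elim (Equivalence.to h _)
T-injective {true}  {true}  _ = refl

-- The rim of the wheel with m rim vertices; rim vertex i < m has label suc i in Wheel (suc m).

module Rim (m : ℕ) where

  next : ℕ → ℕ
  next i with suc i ≟ m
  ... | yes _ = 0
  ... | no  _ = suc i

  prev : ℕ → ℕ
  prev zero    = pred m
  prev (suc i) = i

  next-last : ∀ {i} → suc i ≡ m → next i ≡ 0
  next-last {i} eq with suc i ≟ m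
  ... | yes _   = refl
  ... | no  neq = ⊥-elim (neq eq)

  next-suc : ∀ {i} → suc i < m → next i ≡ suc i
  next-suc {i} lt with suc i ≟ m
  ... | yes eq = ⊥-elim (<-irrefl eq lt)
  ... | no  _  = refl

  next-< : ∀ {i} → i < m → next i < m
  next-< {i} i<m with suc i ≟ m
  ... | yes _   = ≤-<-trans z≤n i<m
  ... | no  neq = ≤∧≢⇒< i<m neq

  prev-< : ∀ {i} → i < m → prev i < m
  prev-< {zero}  (s≤s _) = n<1+n _
  prev-< {suc i} i<m     = <-trans (n<1+n i) i<m

  next-prev : ∀ {i} → i < m → next (prev i) ≡ i
  next-prev {zero}  (s≤s _) = next-last refl
  next-prev {suc i} i<m     = next-suc i<m

  prev-next : ∀ {i} → i < m → prev (next i) ≡ i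
  prev-next {i} i<m with suc i ≟ m
  ... | yes refl = refl
  ... | no  _    = refl

  next≢prev : 3 ≤ m → ∀ {i} → i < m → next i ≢ prev i
  next≢prev 3≤m {zero} _ eq with 1 ≟ m
  ... | yes 1≡m = <-irrefl 1≡m (≤-trans (s≤s (s≤s z≤n)) 3≤m)
  ... | no  _   = pred≢1 3≤m (sym eq)
    where
    pred≢1 : ∀ {k} → 3 ≤ k → pred k ≢ 1
    pred≢1 (s≤s (s≤s (s≤s _))) ()
  next≢prev 3≤m {suc i} i<m eq with suc (suc i) ≟ m
  ... | yes 2+i≡m = <-irrefl (trans (cong (2 +_) eq) 2+i≡m) 3≤m
  ... | no  _     = <-irrefl (sym eq) (n≤1+n (suc i))

  private
    T-∨⁴ : ∀ {a b c d} → T (a ∨ b ∨ c ∨ d) ⇔ (T a ⊎ T b ⊎ T c ⊎ T d)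
    T-∨⁴ = mk⇔
      (Sum.map₂ (Sum.map₂ (Equivalence.to T-∨) ∘ Equivalence.to T-∨) ∘ Equivalence.to T-∨)
      (Equivalence.from T-∨ ∘ Sum.map₂ (Equivalence.from T-∨ ∘ Sum.map₂ (Equivalence.from T-∨)))

    RimAdjacency : ℕ → ℕ → Set
    RimAdjacency i j =
      T (suc i ≡ᵇ j) ⊎ T (suc j ≡ᵇ i) ⊎ T ((i ≡ᵇ 0) ∧ (suc j ≡ᵇ m)) ⊎ T ((j ≡ᵇ 0) ∧ (suc i ≡ᵇ m))

    rim-adjacency⇒ : ∀ {i j} → j < m → RimAdjacency i j → j ≡ next i ⊎ j ≡ prev i
    rim-adjacency⇒ {i} {j} j<m (inj₁ t) with refl ← ≡ᵇ⇒≡ (suc i) j t = inj₁ (sym (next-suc j<m))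
    rim-adjacency⇒ {i} {j} _ (inj₂ (inj₁ t)) with refl ← ≡ᵇ⇒≡ (suc j) i t = inj₂ refl
    rim-adjacency⇒ {i} {j} _ (inj₂ (inj₂ (inj₁ t))) with Equivalence.to T-∧ t
    ... | t₁ , t₂ with refl ← ≡ᵇ⇒≡ i 0 t₁ | refl ← ≡ᵇ⇒≡ (suc j) m t₂ = inj₂ refl
    rim-adjacency⇒ {i} {j} _ (inj₂ (inj₂ (inj₂ t))) with Equivalence.to T-∧ t
    ... | t₁ , t₂ with refl ← ≡ᵇ⇒≡ j 0 t₁ = inj₁ (sym (next-last (≡ᵇ⇒≡ (suc i) m t₂)))

    ⇒rim-adjacency : ∀ {i j} → i < m → j ≡ next i ⊎ j ≡ prev i → RimAdjacency i j
    ⇒rim-adjacency {i} _ (inj₁ refl) with suc i ≟ m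
    ... | yes 1+i≡m = inj₂ (inj₂ (inj₂ (Equivalence.from T-∧ (_ , ≡⇒≡ᵇ (suc i) m 1+i≡m))))
    ... | no  _     = inj₁ (≡⇒≡ᵇ i i refl)
    ⇒rim-adjacency {zero}  (s≤s _) (inj₂ refl) =
      inj₂ (inj₂ (inj₁ (Equivalence.from T-∧ (_ , ≡⇒≡ᵇ m m refl))))
    ⇒rim-adjacency {suc i} _       (inj₂ refl) = inj₂ (inj₁ (≡⇒≡ᵇ i i refl))

  rim-adjacent⇔ : ∀ {i j} → i < m → j < m →
                  T (wheelAdjℕ (suc m) (suc i) (suc j)) ⇔ (j ≡ next i ⊎ j ≡ prev i)
  rim-adjacent⇔ i<m j<m =
    mk⇔ (rim-adjacency⇒ j<m ∘ Equivalence.to T-∨⁴) (Equivalence.from T-∨⁴ ∘ ⇒rim-adjacency i<m)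

  count-rim-neighbours : 3 ≤ m → ∀ {i} → i < m → count (wheelAdjℕ (suc m) (suc i)) (suc m) ≡ 3
  count-rim-neighbours 3≤m {i} i<m =
    cong suc (trans (count-cong adjacency≡) (count-≡ᵇ-pair (next≢prev 3≤m i<m) (next-< i<m) (prev-< i<m)))
    where
    adjacency≡ : ∀ {j} → j < m →
                 wheelAdjℕ (suc m) (suc i) (suc j) ≡ (j ≡ᵇ next i) ∨ (j ≡ᵇ prev i)
    adjacency≡ {j} j<m = T-injective (mk⇔
      (λ adj → Equivalence.from T-∨ (Sum.map (≡⇒≡ᵇ j (next i)) (≡⇒≡ᵇ j (prev i))
                                        (Equivalence.to (rim-adjacent⇔ i<m j<m) adj)))
      (λ t → Equivalence.from (rim-adjacent⇔ i<m j<m)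
               (Sum.map (≡ᵇ⇒≡ j (next i)) (≡ᵇ⇒≡ j (prev i)) (Equivalence.to T-∨ t))))

-- A value of the interval missed by f would leave d + 1 distinct values in d places.
injective-fills-interval : ∀ {d} (f : Fin (suc d) → ℕ) {b} →
  (∀ {i j} → f i ≡ f j → i ≡ j) → (∀ i → b ≤ f i × f i ≤ b + d) →
  ∀ {k} → b ≤ k → k ≤ b + d → ∃ λ i → f i ≡ k
injective-fills-interval {d} f {b} f-injective bounds {k} b≤k k≤b+d with any? (λ i → f i ≟ k)
... | yes hit  = hit
... | no  miss = ⊥-elim (collision (pigeonhole (n<1+n d) squeeze))
  where
  offset : ∀ {x} → b ≤ x × x ≤ b + d → Fin (suc d)
  offset {x} (_ , x≤b+d) = fromℕ< (s≤s (m≤n+o⇒m∸n≤o x b x≤b+d))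
  offset-injective : ∀ {x y} (x∈ : b ≤ x × x ≤ b + d) (y∈ : b ≤ y × y ≤ b + d) →
                     offset x∈ ≡ offset y∈ → x ≡ y
  offset-injective (b≤x , _) (b≤y , _) eq =
    ∸-cancelʳ-≡ b≤x b≤y (trans (sym (toℕ-fromℕ< _)) (trans (cong toℕ eq) (toℕ-fromℕ< _)))
  target≢slot : ∀ i → offset (b≤k , k≤b+d) ≢ offset (bounds i)
  target≢slot i eq = miss (i , sym (offset-injective (b≤k , k≤b+d) (bounds i) eq))
  squeeze : Fin (suc d) → Fin d
  squeeze i = punchOut (target≢slot i)
  collision : (∃₂ λ i j → Data.Fin._<_ i j × squeeze i ≡ squeeze j) → ⊥
  collision (i , j , i<j , same) = Fin.<⇒≢ i<j (f-injective
    (offset-injective (bounds i) (bounds j) (punchOut-injective (target≢slot i) (target≢slot j) same)))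

Consecutive : ℕ → List ℕ → Set
Consecutive b xs = xs ↭ applyUpTo (_+ b) (length xs)

∈-applyUpTo-+⇔ : ∀ b d k → (b ≤ k × k ≤ b + d) ⇔ k ∈ applyUpTo (_+ b) (suc d)
∈-applyUpTo-+⇔ b d k = mk⇔ to from
  where
  to : b ≤ k × k ≤ b + d → k ∈ applyUpTo (_+ b) (suc d)
  to (b≤k , k≤b+d) =
    subst (_∈ applyUpTo (_+ b) (suc d)) (m∸n+n≡m b≤k)
          (∈-applyUpTo⁺ (_+ b) (s≤s (m≤n+o⇒m∸n≤o k b k≤b+d)))
  from : k ∈ applyUpTo (_+ b) (suc d) → b ≤ k × k ≤ b + d
  from k∈ with ∈-applyUpTo⁻ (_+ b) k∈
  ... | j , s≤s j≤d , refl = m≤n+m b j , subst (j + b ≤_) (+-comm d b) (+-monoˡ-≤ b j≤d)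

Consecutive-∈⇔ : ∀ {b x xs} → Consecutive b (x ∷ xs) →
                 ∀ k → (b ≤ k × k ≤ b + length xs) ⇔ k ∈ x ∷ xs
Consecutive-∈⇔ {b} {x} {xs} σ k = mk⇔
  (λ k∈I → ∈-resp-↭ (↭-sym σ) (Equivalence.to (∈-applyUpTo-+⇔ b (length xs) k) k∈I))
  (λ k∈xs → Equivalence.from (∈-applyUpTo-+⇔ b (length xs) k) (∈-resp-↭ σ k∈xs))

Consecutive⇒Unique : ∀ {b xs} → Consecutive b xs → Unique xs
Consecutive⇒Unique {b} {xs} σ =
  ↭ₛ.Unique-resp-↭ (setoid ℕ) (↭⇒↭ₛ (↭-sym σ))
    (applyUpTo⁺₁ (_+ b) (length xs) (λ i<j _ eq → <⇒≢ i<j (+-cancelʳ-≡ b _ _ eq)))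

module _ (G : Graph) (c : Fin (V G) → ℕ) (e : Fin (V G) → Fin (V G) → ℕ) where

  SeenAt : Fin (V G) → ℕ → Set
  SeenAt x k = c x ≡ k ⊎ ∃ λ y → Adj G x y × e x y ≡ k

  IntervalAt : ℕ → ℕ → Fin (V G) → Set
  IntervalAt t d x = ∃ λ a → 1 ≤ a × a + d ≤ t × (∀ k → (a ≤ k × k ≤ a + d) ⇔ SeenAt x k)

  seen⇒used : ∀ x {k} → SeenAt x k →
              (∃ λ x → c x ≡ k) ⊎ (∃ λ x → ∃ λ y → Adj G x y × e x y ≡ k)
  seen⇒used x (inj₁ eq)             = inj₁ (x , eq)
  seen⇒used x (inj₂ (y , adj , eq)) = inj₂ (x , y , adj , eq)

  seen-within : ∀ {t d} x {k} → IntervalAt t d x → SeenAt x k → 1 ≤ k × k ≤ t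
  seen-within _ (a , 1≤a , a+d≤t , interval) seen with Equivalence.from (interval _) seen
  ... | a≤k , k≤a+d = ≤-trans 1≤a a≤k , ≤-trans k≤a+d a+d≤t

-- A criterion for interval total colourings of wheels

-- spoke i, vertex i and rimEdge i are the colours of u v_{i+1}, of v_{i+1} and of v_{i+1} v_{i+2}
-- (indices of the paper, taken cyclically); hubStart is the least colour seen at the hub.
record WheelPattern (m t : ℕ) : Set where
  open Rim m using (next; prev)
  field
    hub hubStart         : ℕ
    spoke vertex rimEdge : ℕ → ℕ
    hubStart-positive    : 1 ≤ hubStart
    hub-fits             : hubStart + m ≤ t
    hub-within           : hubStart ≤ hub × hub ≤ hubStart + m
    spoke-within         : ∀ {i} → i < m → hubStart ≤ spoke i × spoke i ≤ hubStart + m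
    spoke-injective      : ∀ {i j} → i < m → j < m → spoke i ≡ spoke j → i ≡ j
    hub≢spoke            : ∀ {i} → i < m → hub ≢ spoke i
    rim-consecutive      : ∀ {i} → i < m → ∃ λ b → 1 ≤ b × b + 3 ≤ t ×
                             Consecutive b (vertex i ∷ spoke i ∷ rimEdge (prev i) ∷ rimEdge i ∷ [])
    vertex≢hub           : ∀ {i} → i < m → vertex i ≢ hub
    vertex≢next          : ∀ {i} → i < m → vertex i ≢ vertex (next i)
    covered              : ∀ {k} → 1 ≤ k → k ≤ t →
                             (hubStart ≤ k × k ≤ hubStart + m) ⊎
                             ∃ λ i → i < m × (vertex i ≡ k ⊎ rimEdge i ≡ k)

module _ {m t : ℕ} (3≤m : 3 ≤ m) (W : WheelPattern m t) where
  open WheelPattern W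
  open Rim m

  colourOfVertex : ℕ → ℕ
  colourOfVertex zero    = hub
  colourOfVertex (suc i) = vertex i

  -- only the values on adjacent labels matter
  colourOfEdge : ℕ → ℕ → ℕ
  colourOfEdge zero    zero    = hub
  colourOfEdge zero    (suc j) = spoke j
  colourOfEdge (suc i) zero    = spoke i
  colourOfEdge (suc i) (suc j) with j ≟ next i
  ... | yes _ = rimEdge i
  ... | no  _ = rimEdge j

  colourOfEdge-next : ∀ i → colourOfEdge (suc i) (suc (next i)) ≡ rimEdge i
  colourOfEdge-next i with next i ≟ next i
  ... | yes _   = refl
  ... | no  neq = ⊥-elim (neq refl)

  colourOfEdge-prev : ∀ {i} → i < m → colourOfEdge (suc i) (suc (prev i)) ≡ rimEdge (prev i)
  colourOfEdge-prev {i} i<m with prev i ≟ next i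
  ... | yes eq = ⊥-elim (next≢prev 3≤m i<m (sym eq))
  ... | no  _  = refl

  data RimNeighbour (i : ℕ) : ℕ → Set where
    hubward  : RimNeighbour i 0
    backward : RimNeighbour i (suc (prev i))
    forward  : RimNeighbour i (suc (next i))

  around : ℕ → List ℕ
  around i = vertex i ∷ spoke i ∷ rimEdge (prev i) ∷ rimEdge i ∷ []

  colourAlong : ∀ {i b} → RimNeighbour i b → ℕ
  colourAlong {i} hubward  = spoke i
  colourAlong {i} backward = rimEdge (prev i)
  colourAlong {i} forward  = rimEdge i

  colourAlong-∈ : ∀ {i b} (nb : RimNeighbour i b) → colourAlong nb ∈ around i
  colourAlong-∈ hubward  = there (here refl)
  colourAlong-∈ backward = there (there (here refl))
  colourAlong-∈ forward  = there (there (there (here refl)))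

  colourOfEdge-along : ∀ {i b} → i < m → (nb : RimNeighbour i b) → colourOfEdge (suc i) b ≡ colourAlong nb
  colourOfEdge-along     _   hubward  = refl
  colourOfEdge-along     i<m backward = colourOfEdge-prev i<m
  colourOfEdge-along {i} _   forward  = colourOfEdge-next i

  neighbour-< : ∀ {i b} → i < m → RimNeighbour i b → b < suc m
  neighbour-< _   hubward  = s≤s z≤n
  neighbour-< i<m backward = s≤s (prev-< i<m)
  neighbour-< i<m forward  = s≤s (next-< i<m)

  neighbour-adjacent : ∀ {i b} → i < m → RimNeighbour i b → T (wheelAdjℕ (suc m) (suc i) b)
  neighbour-adjacent _   hubward  = _
  neighbour-adjacent i<m backward = Equivalence.from (rim-adjacent⇔ i<m (prev-< i<m)) (inj₂ refl)
  neighbour-adjacent i<m forward  = Equivalence.from (rim-adjacent⇔ i<m (next-< i<m)) (inj₁ refl)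

  classify : ∀ {i b} → i < m → b < suc m → T (wheelAdjℕ (suc m) (suc i) b) → RimNeighbour i b
  classify {b = zero}  _   _         _   = hubward
  classify {b = suc j} i<m (s≤s j<m) adj with Equivalence.to (rim-adjacent⇔ i<m j<m) adj
  ... | inj₁ refl = forward
  ... | inj₂ refl = backward

  colourAlong-injective : ∀ {i b b′} → Unique (around i) →
    (p : RimNeighbour i b) (q : RimNeighbour i b′) → colourAlong p ≡ colourAlong q → b ≡ b′
  colourAlong-injective _ hubward  hubward  _ = refl
  colourAlong-injective _ backward backward _ = refl
  colourAlong-injective _ forward  forward  _ = refl
  colourAlong-injective (_ ∷ (s≢l ∷ _ ∷ []) ∷ _) hubward  backward eq = ⊥-elim (s≢l eq)
  colourAlong-injective (_ ∷ (_ ∷ s≢r ∷ []) ∷ _) hubward  forward  eq = ⊥-elim (s≢r eq)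
  colourAlong-injective (_ ∷ (s≢l ∷ _ ∷ []) ∷ _) backward hubward  eq = ⊥-elim (s≢l (sym eq))
  colourAlong-injective (_ ∷ (_ ∷ s≢r ∷ []) ∷ _) forward  hubward  eq = ⊥-elim (s≢r (sym eq))
  colourAlong-injective (_ ∷ _ ∷ (l≢r ∷ []) ∷ _) backward forward  eq = ⊥-elim (l≢r eq)
  colourAlong-injective (_ ∷ _ ∷ (l≢r ∷ []) ∷ _) forward  backward eq = ⊥-elim (l≢r (sym eq))

  vertex≢colourAlong : ∀ {i b} → Unique (around i) → (p : RimNeighbour i b) → vertex i ≢ colourAlong p
  vertex≢colourAlong ((v≢s ∷ _ ∷ _ ∷ []) ∷ _) hubward  = v≢s
  vertex≢colourAlong ((_ ∷ v≢l ∷ _ ∷ []) ∷ _) backward = v≢l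
  vertex≢colourAlong ((_ ∷ _ ∷ v≢r ∷ []) ∷ _) forward  = v≢r

  vertex≢neighbour : ∀ {i b} → i < m → RimNeighbour i b → vertex i ≢ colourOfVertex b
  vertex≢neighbour i<m hubward  = vertex≢hub i<m
  vertex≢neighbour i<m forward  = vertex≢next i<m
  vertex≢neighbour i<m backward eq =
    vertex≢next (prev-< i<m) (trans (sym eq) (cong vertex (sym (next-prev i<m))))

  colourOfEdge-sym : ∀ {i j} → i < m → RimNeighbour i (suc j) →
                     colourOfEdge (suc i) (suc j) ≡ colourOfEdge (suc j) (suc i)
  colourOfEdge-sym {i} i<m forward = begin
    colourOfEdge (suc i) (suc (next i))               ≡⟨ colourOfEdge-next i ⟩
    rimEdge i                                         ≡⟨ cong rimEdge (prev-next i<m) ⟨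
    rimEdge (prev (next i))                           ≡⟨ colourOfEdge-prev (next-< i<m) ⟨
    colourOfEdge (suc (next i)) (suc (prev (next i)))
      ≡⟨ cong (colourOfEdge (suc (next i)) ∘ suc) (prev-next i<m) ⟩
    colourOfEdge (suc (next i)) (suc i)               ∎
    where open ≡-Reasoning
  colourOfEdge-sym {i} i<m backward = begin
    colourOfEdge (suc i) (suc (prev i))               ≡⟨ colourOfEdge-prev i<m ⟩
    rimEdge (prev i)                                  ≡⟨ colourOfEdge-next (prev i) ⟨
    colourOfEdge (suc (prev i)) (suc (next (prev i)))
      ≡⟨ cong (colourOfEdge (suc (prev i)) ∘ suc) (next-prev i<m) ⟩
    colourOfEdge (suc (prev i)) (suc i)               ∎
    where open ≡-Reasoning

  private
    G : Graph
    G = Wheel (suc m)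

    c : Fin (suc m) → ℕ
    c x = colourOfVertex (toℕ x)

    e : Fin (suc m) → Fin (suc m) → ℕ
    e x y = colourOfEdge (toℕ x) (toℕ y)

    vertexAt : ∀ {b} → b < suc m → Σ (Fin (suc m)) λ y → toℕ y ≡ b
    vertexAt b<1+m = fromℕ< b<1+m , toℕ-fromℕ< b<1+m

  seenAt-rim⇔ : (i : Fin m) → ∀ k → SeenAt G c e (rimVertex i) k ⇔ k ∈ around (toℕ i)
  seenAt-rim⇔ i k = mk⇔ to from
    where
    i<m = toℕ<n i
    to : SeenAt G c e (rimVertex i) k → k ∈ around (toℕ i)
    to (inj₁ refl) = here refl
    to (inj₂ (y , adj , refl)) =
      subst (_∈ around (toℕ i)) (sym (colourOfEdge-along i<m nb)) (colourAlong-∈ nb)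
      where nb = classify i<m (toℕ<n y) adj
    reach : ∀ {b} (nb : RimNeighbour (toℕ i) b) → SeenAt G c e (rimVertex i) (colourAlong nb)
    reach nb with vertexAt (neighbour-< i<m nb)
    ... | y , refl = inj₂ (y , neighbour-adjacent i<m nb , colourOfEdge-along i<m nb)
    from : k ∈ around (toℕ i) → SeenAt G c e (rimVertex i) k
    from (here refl)                         = inj₁ refl
    from (there (here refl))                 = reach hubward
    from (there (there (here refl)))         = reach backward
    from (there (there (there (here refl)))) = reach forward

  hubColour : Fin (suc m) → ℕ
  hubColour hubVertex     = hub
  hubColour (rimVertex j) = spoke (toℕ j)

  seenAt-hub⇔ : ∀ k → SeenAt G c e hubVertex k ⇔ ∃ λ j → hubColour j ≡ k
  seenAt-hub⇔ k = mk⇔ to from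
    where
    to : SeenAt G c e hubVertex k → ∃ λ j → hubColour j ≡ k
    to (inj₁ eq)                     = hubVertex , eq
    to (inj₂ (rimVertex j , _ , eq)) = rimVertex j , eq
    from : (∃ λ j → hubColour j ≡ k) → SeenAt G c e hubVertex k
    from (hubVertex , eq)   = inj₁ eq
    from (rimVertex j , eq) = inj₂ (rimVertex j , _ , eq)

  hubColour-injective : ∀ {j j′} → hubColour j ≡ hubColour j′ → j ≡ j′
  hubColour-injective {hubVertex}   {hubVertex}    _  = refl
  hubColour-injective {hubVertex}   {rimVertex j′} eq = ⊥-elim (hub≢spoke (toℕ<n j′) eq)
  hubColour-injective {rimVertex j} {hubVertex}    eq = ⊥-elim (hub≢spoke (toℕ<n j) (sym eq))
  hubColour-injective {rimVertex j} {rimVertex j′} eq =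
    cong rimVertex (toℕ-injective (spoke-injective (toℕ<n j) (toℕ<n j′) eq))

  hubColour-within : ∀ j → hubStart ≤ hubColour j × hubColour j ≤ hubStart + m
  hubColour-within hubVertex     = hub-within
  hubColour-within (rimVertex j) = spoke-within (toℕ<n j)

  degree-hub : degree G hubVertex ≡ m
  degree-hub = trans (sum-allFin-indicator (suc m) (wheelAdjℕ (suc m) 0)) (count-true m)

  degree-rim : (i : Fin m) → degree G (rimVertex i) ≡ 3
  degree-rim i = trans (sum-allFin-indicator (suc m) (wheelAdjℕ (suc m) (suc (toℕ i))))
                       (count-rim-neighbours 3≤m (toℕ<n i))

  interval-hub : IntervalAt G c e t (degree G hubVertex) hubVertex
  interval-hub rewrite degree-hub = hubStart , hubStart-positive , hub-fits , λ k → mk⇔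
    (λ (lo , hi) → Equivalence.from (seenAt-hub⇔ k)
                     (injective-fills-interval hubColour hubColour-injective hubColour-within lo hi))
    (λ seen → within (Equivalence.to (seenAt-hub⇔ k) seen))
    where
    within : ∀ {k} → (∃ λ j → hubColour j ≡ k) → hubStart ≤ k × k ≤ hubStart + m
    within (j , refl) = hubColour-within j

  interval-rim : (i : Fin m) → IntervalAt G c e t (degree G (rimVertex i)) (rimVertex i)
  interval-rim i rewrite degree-rim i with rim-consecutive (toℕ<n i)
  ... | b , 1≤b , b+3≤t , σ =
    b , 1≤b , b+3≤t , λ k → ⇔-sym (seenAt-rim⇔ i k) ⇔-∘ Consecutive-∈⇔ σ k

  private
    unique-around : ∀ {i} → i < m → Unique (around i)
    unique-around i<m with rim-consecutive i<m
    ... | _ , _ , _ , σ = Consecutive⇒Unique σ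

    interval : ∀ x → IntervalAt G c e t (degree G x) x
    interval hubVertex     = interval-hub
    interval (rimVertex i) = interval-rim i

    edge-sym : ∀ x y → Adj G x y → e x y ≡ e y x
    edge-sym hubVertex     (rimVertex _) _   = refl
    edge-sym (rimVertex _) hubVertex     _   = refl
    edge-sym (rimVertex i) (rimVertex j) adj =
      colourOfEdge-sym (toℕ<n i) (classify (toℕ<n i) (toℕ<n (rimVertex j)) adj)

    vertex-proper : ∀ x y → Adj G x y → c x ≢ c y
    vertex-proper hubVertex     (rimVertex j) _   = vertex≢hub (toℕ<n j) ∘ sym
    vertex-proper (rimVertex i) y             adj =
      vertex≢neighbour (toℕ<n i) (classify (toℕ<n i) (toℕ<n y) adj)

    edge-proper : ∀ x y z → Adj G x y → Adj G x z → y ≢ z → e x y ≢ e x z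
    edge-proper hubVertex (rimVertex j) (rimVertex j′) _ _ j≢j′ eq = j≢j′ (hubColour-injective eq)
    edge-proper (rimVertex i) y z adj-y adj-z y≢z eq =
      y≢z (toℕ-injective (colourAlong-injective (unique-around i<m) p q
        (trans (sym (colourOfEdge-along i<m p)) (trans eq (colourOfEdge-along i<m q)))))
      where
      i<m = toℕ<n i
      p = classify i<m (toℕ<n y) adj-y
      q = classify i<m (toℕ<n z) adj-z

    incidence-proper : ∀ x y → Adj G x y → c x ≢ e x y
    incidence-proper hubVertex (rimVertex j) _ = hub≢spoke (toℕ<n j)
    incidence-proper (rimVertex i) y adj eq =
      vertex≢colourAlong (unique-around i<m) nb (trans eq (colourOfEdge-along i<m nb))
      where
      i<m = toℕ<n i
      nb = classify i<m (toℕ<n y) adj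

    used : ∀ {k} → 1 ≤ k → k ≤ t →
           (∃ λ x → c x ≡ k) ⊎ (∃ λ x → ∃ λ y → Adj G x y × e x y ≡ k)
    used 1≤k k≤t with covered 1≤k k≤t
    ... | inj₁ (lo , hi) = seen⇒used G c e hubVertex (Equivalence.from (seenAt-hub⇔ _)
                             (injective-fills-interval hubColour hubColour-injective hubColour-within lo hi))
    ... | inj₂ (i , i<m , on-rim) = seen⇒used G c e (rimVertex (fromℕ< i<m))
            (Equivalence.from (seenAt-rim⇔ (fromℕ< i<m) _)
              (subst (λ j → _ ∈ around j) (sym (toℕ-fromℕ< i<m)) (rim-∈ on-rim)))
      where
      rim-∈ : ∀ {i k} → vertex i ≡ k ⊎ rimEdge i ≡ k → k ∈ around i
      rim-∈ (inj₁ refl) = here refl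
      rim-∈ (inj₂ refl) = there (there (there (here refl)))

  wheel-colouring : IntervalTotalColoring (Wheel (suc m)) t
  wheel-colouring = record
    { c           = c
    ; e           = e
    ; e-sym       = edge-sym
    ; c-range     = λ x → seen-within G c e x (interval x) (inj₁ refl)
    ; e-range     = λ x y adj → seen-within G c e x (interval x) (inj₂ (y , adj , refl))
    ; vert-proper = vertex-proper
    ; edge-proper = edge-proper
    ; inc-proper  = incidence-proper
    ; surj        = λ _ → used
    ; interval    = λ x → let (a , _ , _ , a-interval) = interval x in a , a-interval
    }

-- The construction

double : ℕ → ℕ
double zero    = zero
double (suc k) = suc (suc (double k))

double-mono : ∀ {a b} → a ≤ b → double a ≤ double b
double-mono z≤n       = z≤n
double-mono (s≤s a≤b) = s≤s (s≤s (double-mono a≤b))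

double-injective : ∀ {a b} → double a ≡ double b → a ≡ b
double-injective {zero}  {zero}  _  = refl
double-injective {suc a} {suc b} eq = cong suc (double-injective (suc-injective (suc-injective eq)))

double≢odd : ∀ a b → double a ≢ suc (double b)
double≢odd (suc a) (suc b) eq = double≢odd a b (suc-injective (suc-injective eq))

double≡+ : ∀ a → double a ≡ a + a
double≡+ zero    = refl
double≡+ (suc a) = cong suc (trans (cong suc (double≡+ a)) (sym (+-suc a a)))

data Parity : Set where
  even odd : Parity

bit : Parity → ℕ
bit even = 0
bit odd  = 1

peakVertex afterPeakVertex peakEdge : Parity → ℕ → ℕ
peakVertex even q = 13 + double q
peakVertex odd  q = 12 + double q
afterPeakVertex even q = 11 + double q
afterPeakVertex odd  q = 14 + double q
peakEdge p q = bit p + (12 + double q)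

-- Named by the offsets of (vertex, spoke, previous rim edge, next rim edge) above the least
-- colour at a rim vertex.
perm-0213 : 0 ∷ 2 ∷ 1 ∷ 3 ∷ [] ↭ upTo 4
perm-0213 = ↭-prep 0 (↭-swap 2 1 ↭-refl)

perm-1203 : 1 ∷ 2 ∷ 0 ∷ 3 ∷ [] ↭ upTo 4
perm-1203 = ↭-trans (↭-prep 1 (↭-swap 2 0 ↭-refl)) (↭-swap 1 0 ↭-refl)

perm-2103 : 2 ∷ 1 ∷ 0 ∷ 3 ∷ [] ↭ upTo 4
perm-2103 = ↭-trans (↭-swap 2 1 ↭-refl) perm-1203

perm-3102 : 3 ∷ 1 ∷ 0 ∷ 2 ∷ [] ↭ upTo 4
perm-3102 = ↭-trans (↭-swap 3 1 ↭-refl)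
                    (↭-trans (↭-prep 1 (↭-swap 3 0 ↭-refl)) (↭-swap 1 0 (↭-swap 3 2 ↭-refl)))

perm-2130 : 2 ∷ 1 ∷ 3 ∷ 0 ∷ [] ↭ upTo 4
perm-2130 = ↭-trans (↭-swap 2 1 (↭-swap 3 0 ↭-refl)) perm-1203

perm-1230 : 1 ∷ 2 ∷ 3 ∷ 0 ∷ [] ↭ upTo 4
perm-1230 = ↭-trans (↭-prep 1 (↭-prep 2 (↭-swap 3 0 ↭-refl))) perm-1203

perm-3120 : 3 ∷ 1 ∷ 2 ∷ 0 ∷ [] ↭ upTo 4
perm-3120 = ↭-trans (↭-swap 3 1 ↭-refl) (↭-trans (↭-prep 1 (↭-swap 3 2 ↭-refl)) perm-1230)

perm-0231 : 0 ∷ 2 ∷ 3 ∷ 1 ∷ [] ↭ upTo 4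
perm-0231 = ↭-prep 0 (↭-trans (↭-prep 2 (↭-swap 3 1 ↭-refl)) (↭-swap 2 1 ↭-refl))

peak-consecutive : ∀ p q →
  Consecutive (10 + double q) (peakVertex p q ∷ 11 + double q ∷ 10 + double q ∷ peakEdge p q ∷ [])
peak-consecutive even q = map⁺ (_+ (10 + double q)) perm-3102
peak-consecutive odd  q = map⁺ (_+ (10 + double q)) perm-2103

afterPeak-consecutive : ∀ p q →
  Consecutive (5 + double (2 + (bit p + q)))
    (afterPeakVertex p q ∷ 4 + double (3 + (bit p + q)) ∷ peakEdge p q ∷ 5 + double (2 + (bit p + q)) ∷ [])
afterPeak-consecutive even q = map⁺ (_+ (9 + double q)) perm-2130
afterPeak-consecutive odd  q = map⁺ (_+ (11 + double q)) perm-3120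

+-cancelʳ-≢ : ∀ {a b} d → a ≢ b → a + d ≢ b + d
+-cancelʳ-≢ {a} {b} d a≢b eq = a≢b (+-cancelʳ-≡ d a b eq)

peakVertex≢afterPeakVertex : ∀ p q → peakVertex p q ≢ afterPeakVertex p q
peakVertex≢afterPeakVertex even q = +-cancelʳ-≢ (double q) (λ ())
peakVertex≢afterPeakVertex odd  q = +-cancelʳ-≢ (double q) (λ ())

afterPeakVertex≢next : ∀ p q → afterPeakVertex p q ≢ 6 + double (bit p + q)
afterPeakVertex≢next even q = +-cancelʳ-≢ (double q) (λ ())
afterPeakVertex≢next odd  q = +-cancelʳ-≢ (double q) (λ ())

peakVertex≥ : ∀ p q → 12 + double q ≤ peakVertex p q
peakVertex≥ even q = n≤1+n _
peakVertex≥ odd  q = ≤-refl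

7<afterPeakVertex : ∀ p q → 7 < afterPeakVertex p q
7<afterPeakVertex even q = m≤m+n 8 (3 + double q)
7<afterPeakVertex odd  q = m≤m+n 8 (6 + double q)

double-top≤ : ∀ p q → 10 + double (bit p + q) ≤ 11 + (bit p + double q)
double-top≤ even q = n≤1+n _
double-top≤ odd  q = ≤-refl

peakEdge≡ : ∀ p q → peakEdge p q ≡ 12 + (bit p + double q)
peakEdge≡ even q = refl
peakEdge≡ odd  q = refl

topColour : ∀ p q → peakVertex p q ≡ 13 + (bit p + double q) ⊎ afterPeakVertex p q ≡ 13 + (bit p + double q)
topColour even q = inj₁ refl
topColour odd  q = inj₂ refl

-- The rim has m = 8 + 2q + bit p vertices (m≡ below). Rim vertices 0, …, peak carry the odd
-- spokes in increasing order; vertex i > peak carries the even spoke 4 + 2r with r = last ∸ i,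
-- and r = top at vertex suc peak.
module Construction (q : ℕ) (p : Parity) where

  peak : ℕ
  peak = 3 + q

  top : ℕ
  top = 3 + (bit p + q)

  last : ℕ
  last = (4 + q) + top

  m : ℕ
  m = suc last

  open Rim m public

  hub : ℕ
  hub = 7

  ascSpoke ascVertex ascEdge descSpoke descVertex descEdge : ℕ → ℕ
  ascSpoke 0             = 3
  ascSpoke 1             = 5
  ascSpoke (suc (suc k)) = 9 + double k

  ascVertex 0 = 1
  ascVertex 1 = 6
  ascVertex 2 = 8
  ascVertex (suc (suc (suc k))) with k ≟ q
  ... | yes _ = peakVertex p q
  ... | no  _ = 9 + double k

  ascEdge 0 = 4
  ascEdge 1 = 7
  ascEdge (suc (suc k)) with k ≟ suc q
  ... | yes _ = peakEdge p q
  ... | no  _ = 10 + double k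

  descSpoke r = 4 + double r

  descVertex 0       = 3
  descVertex (suc r) with suc r ≟ top
  ... | yes _ = afterPeakVertex p q
  ... | no  _ = 4 + double r

  descEdge 0       = 2
  descEdge (suc r) = 5 + double r

  piecewise : (ℕ → ℕ) → (ℕ → ℕ) → ℕ → ℕ
  piecewise asc desc i with i ≤? peak
  ... | yes _ = asc i
  ... | no  _ = desc (last ∸ i)

  piecewise-asc : ∀ {asc desc i} → i ≤ peak → piecewise asc desc i ≡ asc i
  piecewise-asc {i = i} i≤peak with i ≤? peak
  ... | yes _     = refl
  ... | no  i≰peak = ⊥-elim (i≰peak i≤peak)

  piecewise-desc : ∀ {asc desc i r} → i + r ≡ last → peak < i → piecewise asc desc i ≡ desc r
  piecewise-desc {desc = desc} {i} {r} i+r≡last peak<i with i ≤? peak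
  ... | yes i≤peak = ⊥-elim (<⇒≱ peak<i i≤peak)
  ... | no  _      = cong desc (trans (cong (_∸ i) (sym i+r≡last)) (m+n∸m≡n i r))

  spoke vertex rimEdge : ℕ → ℕ
  spoke   = piecewise ascSpoke descSpoke
  vertex  = piecewise ascVertex descVertex
  rimEdge = piecewise ascEdge descEdge

  spoke-asc : ∀ {i} → i ≤ peak → spoke i ≡ ascSpoke i
  spoke-asc = piecewise-asc {ascSpoke} {descSpoke}

  vertex-asc : ∀ {i} → i ≤ peak → vertex i ≡ ascVertex i
  vertex-asc = piecewise-asc {ascVertex} {descVertex}

  rimEdge-asc : ∀ {i} → i ≤ peak → rimEdge i ≡ ascEdge i
  rimEdge-asc = piecewise-asc {ascEdge} {descEdge}

  spoke-desc : ∀ {i r} → i + r ≡ last → peak < i → spoke i ≡ descSpoke r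
  spoke-desc = piecewise-desc {ascSpoke} {descSpoke}

  vertex-desc : ∀ {i r} → i + r ≡ last → peak < i → vertex i ≡ descVertex r
  vertex-desc = piecewise-desc {ascVertex} {descVertex}

  rimEdge-desc : ∀ {i r} → i + r ≡ last → peak < i → rimEdge i ≡ descEdge r
  rimEdge-desc = piecewise-desc {ascEdge} {descEdge}

  desc-region : ∀ {i r} → i + r ≡ last → r ≤ top → peak < i
  desc-region {i} {r} i+r≡last r≤top with suc peak ≤? i
  ... | yes peak<i = peak<i
  ... | no  peak≮i = ⊥-elim (<-irrefl i+r≡last (s≤s (+-mono-≤ (≤-pred (≰⇒> peak≮i)) r≤top)))

  data Position : ℕ → Set where
    first     : Position 0
    second    : Position 1
    third     : Position 2
    rising    : ∀ {k} → k < q → Position (3 + k)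
    atPeak    : Position peak
    afterPeak : Position (suc peak)
    falling   : ∀ {i r} → i + suc r ≡ last → suc r < top → Position i
    closing   : Position last

  position : ∀ {i} → i ≤ last → Position i
  position {0} _ = first
  position {1} _ = second
  position {2} _ = third
  position {suc (suc (suc k))} i≤last with <-cmp k q
  ... | tri< k<q _ _ = rising k<q
  ... | tri≈ _ refl _ = atPeak
  ... | tri> _ _ q<k with m≤n⇒∃[o]m+o≡n q<k
  ...   | j , refl = descending j (+-cancelˡ-≤ (4 + q) j top i≤last′)
    where
    i≤last′ : (4 + q) + j ≤ (4 + q) + top
    i≤last′ = subst (_≤ last) (+-assoc 3 (suc q) j) i≤last
    descending : ∀ j → j ≤ top → Position ((4 + q) + j)
    descending zero _ = subst Position (sym (+-identityʳ (4 + q))) afterPeak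
    descending (suc j) j<top with m≤n⇒m<n∨m≡n j<top
    ... | inj₂ 1+j≡top = subst (λ x → Position ((4 + q) + x)) (sym 1+j≡top) closing
    ... | inj₁ 1+j<top with m≤n⇒∃[o]m+o≡n 1+j<top
    ...   | r , 2+j+r≡top = falling i+1+r≡last 1+r<top
      where
      i+1+r≡last : (4 + q) + suc j + suc r ≡ last
      i+1+r≡last = trans (+-assoc (4 + q) (suc j) (suc r)) (cong ((4 + q) +_) (trans (+-suc (suc j) r) 2+j+r≡top))
      1+r<top : suc r < top
      1+r<top = subst (suc (suc r) ≤_) 2+j+r≡top (s≤s (s≤s (m≤n+m r j)))

  ascVertex-rising : ∀ {k} → k < q → ascVertex (3 + k) ≡ 9 + double k
  ascVertex-rising {k} k<q with k ≟ q
  ... | yes refl = ⊥-elim (<-irrefl refl k<q)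
  ... | no  _    = refl

  ascVertex-peak : ascVertex (3 + q) ≡ peakVertex p q
  ascVertex-peak with q ≟ q
  ... | yes _   = refl
  ... | no  q≢q = ⊥-elim (q≢q refl)

  ascEdge-rising : ∀ {k} → k ≢ suc q → ascEdge (2 + k) ≡ 10 + double k
  ascEdge-rising {k} k≢1+q with k ≟ suc q
  ... | yes k≡1+q = ⊥-elim (k≢1+q k≡1+q)
  ... | no  _     = refl

  ascEdge-peak : ascEdge (3 + q) ≡ peakEdge p q
  ascEdge-peak with suc q ≟ suc q
  ... | yes _     = refl
  ... | no  q≢q   = ⊥-elim (q≢q refl)

  descVertex-falling : ∀ {r} → suc r ≢ top → descVertex (suc r) ≡ 4 + double r
  descVertex-falling {r} 1+r≢top with suc r ≟ top
  ... | yes 1+r≡top = ⊥-elim (1+r≢top 1+r≡top)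
  ... | no  _       = refl

  descVertex-top : descVertex top ≡ afterPeakVertex p q
  descVertex-top with top ≟ top
  ... | yes _       = refl
  ... | no  top≢top = ⊥-elim (top≢top refl)

  rimColours : ℕ → List ℕ
  rimColours i = vertex i ∷ spoke i ∷ rimEdge (prev i) ∷ rimEdge i ∷ []

  rimColours≡ : ∀ i {a b c d} → vertex i ≡ a → spoke i ≡ b → rimEdge (prev i) ≡ c → rimEdge i ≡ d →
            rimColours i ≡ a ∷ b ∷ c ∷ d ∷ []
  rimColours≡ _ refl refl refl refl = refl

  consecutive-shift : ∀ i b {w x y z} → w ∷ x ∷ y ∷ z ∷ [] ↭ upTo 4 →
            rimColours i ≡ w + b ∷ x + b ∷ y + b ∷ z + b ∷ [] → Consecutive b (rimColours i)
  consecutive-shift _ b σ eq = subst (Consecutive b) (sym eq) (map⁺ (_+ b) σ)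

  -- As 3 ≤ spoke i ≤ m + 3, spoke-inner keeps the block within [1, m + 5].
  record Block (i : ℕ) : Set where
    field
      start       : ℕ
      consecutive : Consecutive start (rimColours i)
      spoke-inner : spoke i ≡ 1 + start ⊎ spoke i ≡ 2 + start
      vertex≢hub  : vertex i ≢ hub
      vertex≢next : vertex i ≢ vertex (next i)

  peak<last : peak < last
  peak<last = m≤m+n (4 + q) top

  rimEdge-last : rimEdge last ≡ 2
  rimEdge-last = rimEdge-desc (+-identityʳ last) peak<last

  block-first : Block 0
  block-first = record
    { start       = 1
    ; consecutive = consecutive-shift 0 1 perm-0213 (rimColours≡ 0 refl refl rimEdge-last refl)
    ; spoke-inner = inj₂ refl
    ; vertex≢hub  = λ ()
    ; vertex≢next = λ ()
    }

  block-second : Block 1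
  block-second = record
    { start       = 4
    ; consecutive = consecutive-shift 1 4 perm-2103 refl
    ; spoke-inner = inj₁ refl
    ; vertex≢hub  = λ ()
    ; vertex≢next = λ ()
    }

  block-third : Block 2
  block-third = record
    { start       = 7
    ; consecutive = consecutive-shift 2 7 perm-1203 refl
    ; spoke-inner = inj₂ refl
    ; vertex≢hub  = λ ()
    ; vertex≢next = 8≢vertex₃
    }
    where
    8≢vertex₃ : 8 ≢ vertex 3
    8≢vertex₃ with 0 ≟ q
    ... | yes _ = <⇒≢ (≤-trans (m≤m+n 9 (3 + double q)) (peakVertex≥ p q))
    ... | no  _ = λ ()

  vertex-afterPeak : vertex (suc peak) ≡ afterPeakVertex p q
  vertex-afterPeak = trans (vertex-desc refl ≤-refl) descVertex-top

  rimEdge-peak : rimEdge peak ≡ peakEdge p q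
  rimEdge-peak = trans (rimEdge-asc ≤-refl) ascEdge-peak

  vertex-peak : vertex peak ≡ peakVertex p q
  vertex-peak = trans (vertex-asc ≤-refl) ascVertex-peak

  block-rising : ∀ {k} → k < q → Block (3 + k)
  block-rising {k} k<q = record
    { start       = 9 + double k
    ; consecutive = consecutive-shift (3 + k) (9 + double k) perm-0213
                      (rimColours≡ (3 + k) vertex≡ spoke≡ left≡ right≡)
    ; spoke-inner = inj₂ spoke≡
    ; vertex≢hub  = subst (_≢ hub) (sym vertex≡) (λ ())
    ; vertex≢next = vertex≢next
    }
    where
    asc : 3 + k ≤ peak
    asc = +-monoʳ-≤ 3 (<⇒≤ k<q)
    vertex≡ : vertex (3 + k) ≡ 9 + double k
    vertex≡ = trans (vertex-asc asc) (ascVertex-rising k<q)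
    spoke≡ : spoke (3 + k) ≡ 11 + double k
    spoke≡ = spoke-asc asc
    left≡ : rimEdge (2 + k) ≡ 10 + double k
    left≡ = trans (rimEdge-asc (≤-trans (n≤1+n (2 + k)) asc))
                  (ascEdge-rising (<⇒≢ (≤-trans k<q (n≤1+n q))))
    right≡ : rimEdge (3 + k) ≡ 12 + double k
    right≡ = trans (rimEdge-asc asc) (ascEdge-rising (<⇒≢ (s≤s k<q)))
    ascVertex-next : 9 + double k ≢ ascVertex (4 + k)
    ascVertex-next with suc k ≟ q
    ... | yes _ = <⇒≢ (≤-trans (+-mono-≤ (≤-refl {10}) (double-mono (<⇒≤ k<q)))
                               (≤-trans (m≤n+m _ 2) (peakVertex≥ p q)))
    ... | no  _ = +-cancelʳ-≢ (double k) (λ ())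
    vertex≢next : vertex (3 + k) ≢ vertex (next (3 + k))
    vertex≢next rewrite vertex≡ | next-suc {3 + k} (s≤s (≤-trans (s≤s asc) peak<last))
                      | vertex-asc (+-monoʳ-≤ 3 k<q) = ascVertex-next

  block-peak : Block peak
  block-peak = record
    { start       = 10 + double q
    ; consecutive = subst (Consecutive (10 + double q))
                      (sym (rimColours≡ peak vertex-peak spoke≡ left≡ rimEdge-peak)) (peak-consecutive p q)
    ; spoke-inner = inj₁ spoke≡
    ; vertex≢hub  = subst (_≢ hub) (sym vertex-peak)
                      (>⇒≢ (≤-trans (m≤m+n 8 (4 + double q)) (peakVertex≥ p q)))
    ; vertex≢next = subst₂ _≢_ (sym vertex-peak) (sym (trans (cong vertex next≡) vertex-afterPeak))
                      (peakVertex≢afterPeakVertex p q)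
    }
    where
    spoke≡ : spoke peak ≡ 11 + double q
    spoke≡ = spoke-asc ≤-refl
    left≡ : rimEdge (2 + q) ≡ 10 + double q
    left≡ = trans (rimEdge-asc (n≤1+n _)) (ascEdge-rising (<⇒≢ (n<1+n q)))
    next≡ : next peak ≡ suc peak
    next≡ = next-suc (s≤s (s≤s (m≤m+n (3 + q) top)))

  block-afterPeak : Block (suc peak)
  block-afterPeak = record
    { start       = 5 + double (2 + (bit p + q))
    ; consecutive = subst (Consecutive _)
                      (sym (rimColours≡ (suc peak) vertex-afterPeak spoke≡ rimEdge-peak right≡))
                      (afterPeak-consecutive p q)
    ; spoke-inner = inj₁ spoke≡
    ; vertex≢hub  = subst (_≢ hub) (sym vertex-afterPeak) (>⇒≢ (7<afterPeakVertex p q))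
    ; vertex≢next = subst₂ _≢_ (sym vertex-afterPeak) (sym (trans (cong vertex next≡) vertex≡))
                      (afterPeakVertex≢next p q)
    }
    where
    spoke≡ : spoke (suc peak) ≡ 4 + double top
    spoke≡ = spoke-desc refl ≤-refl
    right≡ : rimEdge (suc peak) ≡ 5 + double (2 + (bit p + q))
    right≡ = rimEdge-desc refl ≤-refl
    next≡ : next (suc peak) ≡ 2 + peak
    next≡ = next-suc (s≤s (s≤s (m<m+n (3 + q) (s≤s z≤n))))
    vertex≡ : vertex (2 + peak) ≡ 6 + double (bit p + q)
    vertex≡ = trans (vertex-desc {2 + peak} (sym (+-suc (4 + q) (2 + (bit p + q))))
                                 (≤-trans (n<1+n peak) (n≤1+n _)))
                    (descVertex-falling (<⇒≢ (n<1+n _)))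

  block-falling : ∀ {i r} → suc i + suc r ≡ last → suc r < top → Block (suc i)
  block-falling {i} {r} i+r≡last r<top = record
    { start       = 4 + double r
    ; consecutive = consecutive-shift (suc i) (4 + double r) perm-0231
                      (rimColours≡ (suc i) vertex≡ spoke≡ left≡ right≡)
    ; spoke-inner = inj₂ spoke≡
    ; vertex≢hub  = subst (_≢ hub) (sym vertex≡) (double≢odd (2 + r) 3)
    ; vertex≢next = subst₂ _≢_ (sym vertex≡) (sym (trans (cong vertex next≡) vertex-next≡))
                      (descVertex-below r<top)
    }
    where
    i+r≡last′ : i + suc (suc r) ≡ last
    i+r≡last′ = trans (+-suc i (suc r)) i+r≡last
    vertex≡ : vertex (suc i) ≡ 4 + double r
    vertex≡ = trans (vertex-desc {suc i} {suc r} i+r≡last (desc-region i+r≡last (<⇒≤ r<top)))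
                    (descVertex-falling (<⇒≢ r<top))
    spoke≡ : spoke (suc i) ≡ 6 + double r
    spoke≡ = spoke-desc {suc i} {suc r} i+r≡last (desc-region i+r≡last (<⇒≤ r<top))
    left≡ : rimEdge i ≡ 7 + double r
    left≡ = rimEdge-desc {i} {2 + r} i+r≡last′ (desc-region i+r≡last′ r<top)
    right≡ : rimEdge (suc i) ≡ 5 + double r
    right≡ = rimEdge-desc {suc i} {suc r} i+r≡last (desc-region i+r≡last (<⇒≤ r<top))
    2+i+r≡last : suc (suc i) + r ≡ last
    2+i+r≡last = trans (sym (+-suc (suc i) r)) i+r≡last
    next≡ : next (suc i) ≡ suc (suc i)
    next≡ = next-suc (s≤s (subst (suc (suc i) ≤_) 2+i+r≡last (m≤m+n (suc (suc i)) r)))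
    vertex-next≡ : vertex (suc (suc i)) ≡ descVertex r
    vertex-next≡ =
      vertex-desc {2 + i} {r} 2+i+r≡last (≤-trans (desc-region i+r≡last (<⇒≤ r<top)) (n≤1+n _))
    descVertex-below : ∀ {r} → suc r < top → 4 + double r ≢ descVertex r
    descVertex-below {zero}  _  = λ ()
    descVertex-below {suc r} lt rewrite descVertex-falling {r} (<⇒≢ (<-trans (n<1+n _) lt)) =
      +-cancelʳ-≢ (double r) (λ ())

  block-closing : Block last
  block-closing = record
    { start       = 2
    ; consecutive = consecutive-shift last 2 perm-1230 (rimColours≡ last vertex≡ spoke≡ left≡ rimEdge-last)
    ; spoke-inner = inj₂ spoke≡
    ; vertex≢hub  = subst (_≢ hub) (sym vertex≡) (λ ())
    ; vertex≢next = subst₂ _≢_ (sym vertex≡) (cong vertex (sym (next-last refl))) (λ ())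
    }
    where
    vertex≡ : vertex last ≡ 3
    vertex≡ = vertex-desc (+-identityʳ last) peak<last
    spoke≡ : spoke last ≡ 4
    spoke≡ = spoke-desc (+-identityʳ last) peak<last
    left≡ : rimEdge (peak + top) ≡ 5
    left≡ = rimEdge-desc {peak + top} {1} (+-comm (peak + top) 1) (m<m+n peak (s≤s z≤n))

  block : ∀ {i} → Position i → Block i
  block first                 = block-first
  block second                = block-second
  block third                 = block-third
  block (rising k<q)          = block-rising k<q
  block atPeak                = block-peak
  block afterPeak             = block-afterPeak
  block (falling {zero} i+r≡last r<top) =
    ⊥-elim (<⇒≱ (desc-region i+r≡last (<⇒≤ r<top)) z≤n)
  block (falling {suc i} i+r≡last r<top) = block-falling i+r≡last r<top
  block closing               = block-closing

  m≡ : m ≡ 8 + (bit p + double q)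
  m≡ = cong (5 +_) (trans (+-comm q (3 + (bit p + q)))
                      (cong (3 +_) (trans (+-assoc (bit p) q q) (cong (bit p +_) (sym (double≡+ q))))))

  ascSpoke-odd : ∀ i → ∃ λ h → ascSpoke i ≡ suc (double h)
  ascSpoke-odd 0             = 1 , refl
  ascSpoke-odd 1             = 2 , refl
  ascSpoke-odd (suc (suc k)) = 4 + k , refl

  ascSpoke-injective : ∀ {i j} → ascSpoke i ≡ ascSpoke j → i ≡ j
  ascSpoke-injective {0}           {0}           _  = refl
  ascSpoke-injective {1}           {1}           _  = refl
  ascSpoke-injective {suc (suc k)} {suc (suc l)} eq =
    cong (2 +_) (double-injective (+-cancelˡ-≡ 9 (double k) (double l) eq))
  ascSpoke-injective {0}           {1}           ()
  ascSpoke-injective {0}           {suc (suc _)} ()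
  ascSpoke-injective {1}           {0}           ()
  ascSpoke-injective {1}           {suc (suc _)} ()
  ascSpoke-injective {suc (suc _)} {0}           ()
  ascSpoke-injective {suc (suc _)} {1}           ()

  ascSpoke≢hub : ∀ i → ascSpoke i ≢ hub
  ascSpoke≢hub 0             ()
  ascSpoke≢hub 1             ()
  ascSpoke≢hub (suc (suc k)) ()

  ascSpoke-within : ∀ {i} → i ≤ peak → 3 ≤ ascSpoke i × ascSpoke i ≤ 11 + double q
  ascSpoke-within {0}           _ = ≤-refl , m≤m+n 3 (8 + double q)
  ascSpoke-within {1}           _ = m≤m+n 3 2 , m≤m+n 5 (6 + double q)
  ascSpoke-within {suc (suc k)} (s≤s (s≤s k≤1+q)) =
    m≤m+n 3 (6 + double k) , +-monoʳ-≤ 9 (double-mono k≤1+q)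

  spoke-cases : ∀ {i} → i < m →
    (i ≤ peak × spoke i ≡ ascSpoke i) ⊎ (∃ λ r → i + r ≡ last × r ≤ top × spoke i ≡ descSpoke r)
  spoke-cases {i} (s≤s i≤last) with i ≤? peak
  ... | yes i≤peak = inj₁ (i≤peak , refl)
  ... | no  i≰peak = inj₂ (last ∸ i , m+[n∸m]≡n i≤last , r≤top , refl)
    where
    r≤top : last ∸ i ≤ top
    r≤top = subst (last ∸ i ≤_) (m+n∸m≡n (4 + q) top) (∸-monoʳ-≤ last (≰⇒> i≰peak))

  spoke-injective : ∀ {i j} → i < m → j < m → spoke i ≡ spoke j → i ≡ j
  spoke-injective {i} {j} i<m j<m eq with spoke-cases i<m | spoke-cases j<m
  ... | inj₁ (_ , sᵢ) | inj₁ (_ , sⱼ) = ascSpoke-injective (trans (sym sᵢ) (trans eq sⱼ))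
  ... | inj₂ (r , i+r , _ , sᵢ) | inj₂ (r′ , j+r′ , _ , sⱼ)
    with refl ← double-injective (+-cancelˡ-≡ 4 _ _ (trans (sym sᵢ) (trans eq sⱼ)))
    = +-cancelʳ-≡ r _ _ (trans i+r (sym j+r′))
  ... | inj₁ (_ , sᵢ) | inj₂ (r , _ , _ , sⱼ) with ascSpoke-odd i
  ...   | h , sᵢ-odd = ⊥-elim (double≢odd (2 + r) h (trans (sym sⱼ) (trans (sym eq) (trans sᵢ sᵢ-odd))))
  spoke-injective {i} {j} i<m j<m eq | inj₂ (r , _ , _ , sᵢ) | inj₁ (_ , sⱼ) with ascSpoke-odd j
  ...   | h , sⱼ-odd = ⊥-elim (double≢odd (2 + r) h (trans (sym sᵢ) (trans eq (trans sⱼ sⱼ-odd))))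

  hub≢spoke : ∀ {i} → i < m → hub ≢ spoke i
  hub≢spoke {i} i<m eq with spoke-cases i<m
  ... | inj₁ (_ , sᵢ)         = ascSpoke≢hub i (trans (sym sᵢ) (sym eq))
  ... | inj₂ (r , _ , _ , sᵢ) = double≢odd (2 + r) 3 (trans (sym sᵢ) (sym eq))

  spoke-within : ∀ {i} → i < m → 3 ≤ spoke i × spoke i ≤ 3 + m
  spoke-within i<m with spoke-cases i<m
  ... | inj₁ (i≤peak , sᵢ) rewrite sᵢ | m≡ =
    proj₁ (ascSpoke-within i≤peak) ,
    ≤-trans (proj₂ (ascSpoke-within i≤peak)) (+-monoʳ-≤ 11 (m≤n+m (double q) (bit p)))
  ... | inj₂ (r , _ , r≤top , sᵢ) rewrite sᵢ | m≡ =
    m≤m+n 3 (1 + double r) ,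
    ≤-trans (+-monoʳ-≤ 4 (double-mono r≤top)) (double-top≤ p q)

  blockAt : ∀ {i} → i < m → Block i
  blockAt (s≤s i≤last) = block (position i≤last)

  8≤m : 8 ≤ m
  8≤m = subst (8 ≤_) (sym m≡) (m≤m+n 8 (bit p + double q))

  5+m≡ : suc m + 4 ≡ 5 + m
  5+m≡ = cong suc (+-comm m 4)

  start-fits : ∀ {s b} → 3 ≤ s → s ≤ 3 + m → s ≡ 1 + b ⊎ s ≡ 2 + b → 1 ≤ b × b + 3 ≤ suc m + 4
  start-fits 3≤s s≤3+m (inj₁ refl) = ≤-trans (s≤s z≤n) (≤-pred 3≤s) ,
    subst₂ _≤_ (+-comm 3 _) (sym 5+m≡) (+-monoʳ-≤ 3 (≤-pred s≤3+m))
  start-fits 3≤s s≤3+m (inj₂ refl) = ≤-pred (≤-pred 3≤s) ,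
    subst₂ _≤_ (+-comm 3 _) (sym 5+m≡) (+-monoʳ-≤ 3 (≤-trans (≤-pred (≤-pred s≤3+m)) (n≤1+n _)))

  rim-consecutive : ∀ {i} → i < m → ∃ λ b → 1 ≤ b × b + 3 ≤ suc m + 4 × Consecutive b (rimColours i)
  rim-consecutive i<m =
    let open Block (blockAt i<m)
        (1≤b , b+3≤t) = start-fits (proj₁ (spoke-within i<m)) (proj₂ (spoke-within i<m)) spoke-inner
    in start , 1≤b , b+3≤t , consecutive

  peak<m : peak < m
  peak<m = ≤-trans peak<last (n≤1+n last)

  topVertex : ∃ λ i → i < m × vertex i ≡ 5 + m
  topVertex with topColour p q
  ... | inj₁ eq = peak , peak<m , trans vertex-peak (trans eq (cong (5 +_) (sym m≡)))
  ... | inj₂ eq = suc peak , s≤s peak<last , trans vertex-afterPeak (trans eq (cong (5 +_) (sym m≡)))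

  covered : ∀ {c} → 1 ≤ c → c ≤ suc m + 4 →
            (3 ≤ c × c ≤ 3 + m) ⊎ ∃ λ i → i < m × (vertex i ≡ c ⊎ rimEdge i ≡ c)
  covered {1} _ _ = inj₂ (0 , s≤s z≤n , inj₁ refl)
  covered {2} _ _ = inj₂ (last , ≤-refl , inj₂ rimEdge-last)
  covered {c@(suc (suc (suc _)))} _ c≤t with c ≤? 3 + m | c ≤? 4 + m
  ... | yes c≤3+m | _ = inj₁ (s≤s (s≤s (s≤s z≤n)) , c≤3+m)
  ... | no  c≰3+m | yes c≤4+m = inj₂ (peak , peak<m , inj₂ (trans rimEdge-peak
          (trans (peakEdge≡ p q) (trans (cong (4 +_) (sym m≡)) (≤-antisym (≰⇒> c≰3+m) c≤4+m)))))
  ... | no  _       | no c≰4+m with topVertex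
  ...   | i , i<m , top≡ =
    inj₂ (i , i<m , inj₁ (trans top≡ (≤-antisym (≰⇒> c≰4+m) (subst (c ≤_) 5+m≡ c≤t))))

  wheelPattern : WheelPattern m (suc m + 4)
  wheelPattern = record
    { hub               = hub
    ; hubStart          = 3
    ; spoke             = spoke
    ; vertex            = vertex
    ; rimEdge           = rimEdge
    ; hubStart-positive = s≤s z≤n
    ; hub-fits          = subst (3 + m ≤_) (sym 5+m≡) (+-monoˡ-≤ m (m≤m+n 3 2))
    ; hub-within        = m≤m+n 3 4 , +-monoʳ-≤ 3 (≤-trans (m≤m+n 4 4) 8≤m)
    ; spoke-within      = spoke-within
    ; spoke-injective   = spoke-injective
    ; hub≢spoke         = hub≢spoke
    ; rim-consecutive   = rim-consecutive
    ; vertex≢hub        = λ i<m → Block.vertex≢hub (blockAt i<m)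
    ; vertex≢next       = λ i<m → Block.vertex≢next (blockAt i<m)
    ; covered           = covered
    }

halve : ∀ k → ∃₂ λ q p → bit p + double q ≡ k
halve zero = 0 , even , refl
halve (suc k) with halve k
... | q , even , refl = q , odd , refl
... | q , odd  , refl = suc q , even , refl

lemma4 : (n : ℕ) → 9 ≤ n → IntervalTotalColoring (Wheel n) (n + 4)
lemma4 n 9≤n with m≤n⇒∃[o]m+o≡n 9≤n
... | k , refl with halve k
...   | q , p , refl =
  subst (λ n → IntervalTotalColoring (Wheel n) (n + 4)) (cong suc m≡)
        (wheel-colouring (s≤s (s≤s (s≤s z≤n))) wheelPattern)
  where open Construction q p
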